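{- Let $G$ be an $n$-vertex class-proper interval $k$-graph with a class-proper representation $\{I_{v_i}=[l(v_i),r(v_i)] : 1\le i\le n\}$, where $V(G)=\{v_1,\dots,v_n\}$ and $r(v_i)<r(v_j)$ if and only if $i<j$. Then for every $1\le i\le n$, the closed neighborhood $N_H[v_i]$ induces a complete multipartite graph in $H=G\setminus\{v_1,v_2,\dots,v_{i-1}\}$.
   Context: All graphs are finite and simple. A graph $G$ is an interval $k$-graph if there is a one-to-one correspondence $v\mapsto I_v$ between $V(G)$ and a family of closed intervals of the real line, together with a partition of the family into at most $k$ classes, such that distinct vertices $u,v$ are adjacent if and only if $I_u\cap I_v\neq\emptyset$ and $I_u,I_v$ lie in different classes. A class-proper representation is such a representation in which no interval properly contains another interval of the same class; $G$ is a class-proper interval $k$-graph if it has one. $G\setminus S$ denotes the subgraph induced on $V(G)\setminus S$, and $N_H[v]$ is the closed neighborhood of $v$ in $H$.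
   Formalization: The endpoints of the intervals $I_{v_i}$ in the class-proper representation are rational rather than real. -}

module Defs where

open import Data.Nat using (ℕ)
import Data.Nat as ℕ
open import Data.Fin using (Fin; toℕ)
open import Data.Rational using (ℚ; _≤_; _<_)
open import Data.Product using (Σ; _×_; _,_)
open import Data.Sum using (_⊎_)
open import Relation.Nullary using (¬_)
open import Relation.Binary.PropositionalEquality using (_≡_; _≢_)
open import Function.Bundles using (_⇔_)

record IntervalRep (n k : ℕ) : Set where
  field
    left  : Fin n → ℚ
    right : Fin n → ℚ
    wf    : ∀ v → left v ≤ right v
    cls   : Fin n → Fin k
open IntervalRep public

Intersect : ∀ {n k} → IntervalRep n k → Fin n → Fin n → Set
Intersect R u v = (left R u ≤ right R v) × (left R v ≤ right R u)

Adj : ∀ {n k} → IntervalRep n k → Fin n → Fin n → Set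
Adj R u v = (u ≢ v) × Intersect R u v × (cls R u ≢ cls R v)

Contained : ∀ {n k} → IntervalRep n k → Fin n → Fin n → Set
Contained R u v = (left R v ≤ left R u) × (right R u ≤ right R v)

ProperlyContained : ∀ {n k} → IntervalRep n k → Fin n → Fin n → Set
ProperlyContained R u v = Contained R u v × ¬ Contained R v u

ClassProper : ∀ {n k} → IntervalRep n k → Set
ClassProper R = ∀ u v → cls R u ≡ cls R v → ¬ ProperlyContained R u v

SortedByRight : ∀ {n k} → IntervalRep n k → Set
SortedByRight R = ∀ i j → (toℕ i ℕ.< toℕ j) ⇔ (right R i < right R j)

-- membership in N_H[v_i], where H = G \ {v_j : j < i}
InClosedNbhdAfter : ∀ {n k} → IntervalRep n k → Fin n → Fin n → Set
InClosedNbhdAfter R i u = (u ≡ i) ⊎ ((toℕ i ℕ.≤ toℕ u) × Adj R u i)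

CompleteMultipartiteOn : ∀ {n} → (Fin n → Fin n → Set) → (Fin n → Set) → Set
CompleteMultipartiteOn {n} E S =
  Σ (Fin n → ℕ) λ p → ∀ u v → S u → S v → u ≢ v → E u v ⇔ (p u ≢ p v)

{-# OPTIONS --safe #-}
-- All intervals of N_H[v_i] contain the point r(v_i): v_i's own interval ends
-- there, and every later neighbour meets I_{v_i} yet ends to the right of it.
-- So the intervals in N_H[v_i] pairwise intersect, adjacency inside it reduces
-- to lying in different classes, and the classes are the parts.
module Submission where

open import Defs
open import Data.Nat using (ℕ; _<_)
import Data.Nat.Properties as ℕ
open import Data.Fin using (Fin; toℕ)
open import Data.Fin.Properties using (toℕ-injective)
open import Data.Rational using (ℚ; _≤_)
import Data.Rational.Properties as ℚ
open import Data.Product using (_×_; _,_)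
open import Data.Sum using (inj₁; inj₂)
open import Relation.Binary.PropositionalEquality using (_≢_; refl; cong; sym)
open import Function.Bundles using (_⇔_; mk⇔; Equivalence)

module _ {n k : ℕ} (R : IntervalRep n k) where

  Covers : Fin n → ℚ → Set
  Covers u x = (left R u ≤ x) × (x ≤ right R u)

  covers⇒intersect : ∀ {u v x} → Covers u x → Covers v x → Intersect R u v
  covers⇒intersect (lu≤x , x≤ru) (lv≤x , x≤rv) = ℚ.≤-trans lu≤x x≤rv , ℚ.≤-trans lv≤x x≤ru

  pairwiseIntersecting⇒completeMultipartite : (S : Fin n → Set) →
    (∀ u v → S u → S v → Intersect R u v) → CompleteMultipartiteOn (Adj R) S
  pairwiseIntersecting⇒completeMultipartite S intersect =
    (λ u → toℕ (cls R u)) , adj⇔differentClass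
    where
    adj⇔differentClass : ∀ u v → S u → S v → u ≢ v →
      Adj R u v ⇔ (toℕ (cls R u) ≢ toℕ (cls R v))
    adj⇔differentClass u v su sv u≢v = mk⇔
      (λ { (_ , _ , cu≢cv) → λ eq → cu≢cv (toℕ-injective eq) })
      (λ ne → u≢v , intersect u v su sv , λ eq → ne (cong toℕ eq))

  closedNbhdAfter⇒covers-right : SortedByRight R → ∀ {i u} →
    InClosedNbhdAfter R i u → Covers u (right R i)
  closedNbhdAfter⇒covers-right _ {u = u} (inj₁ refl) = wf R u , ℚ.≤-refl
  closedNbhdAfter⇒covers-right sorted {i} {u} (inj₂ (i≤u , (u≢i , (lu≤ri , _) , _))) =
    lu≤ri , ℚ.<⇒≤ (Equivalence.to (sorted i u) i<u)
    where
    i<u : toℕ i < toℕ u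
    i<u = ℕ.≤∧≢⇒< i≤u (λ eq → u≢i (sym (toℕ-injective eq)))

proposition4p1 : (n k : ℕ) (R : IntervalRep n k) → ClassProper R → SortedByRight R →
    (i : Fin n) → CompleteMultipartiteOn (Adj R) (InClosedNbhdAfter R i)
proposition4p1 n k R _ sorted i =
  pairwiseIntersecting⇒completeMultipartite R (InClosedNbhdAfter R i)
    λ u v su sv → covers⇒intersect R (covers-right su) (covers-right sv)
  where
  covers-right : ∀ {u} → InClosedNbhdAfter R i u → Covers R u (right R i)
  covers-right = closedNbhdAfter⇒covers-right R sorted
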